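{- Let $A$ be a nondeterministic Büchi automaton over $2^{I \cup O}$ with states $S = \{s_0,\dots,s_{k-1}\}$, in which every state and transition lies on an accepting run, and let $X \subseteq O$ be automata dependent on $I \cup (O\setminus X)$ in $A$. For each transition $(s,s')$ with label $B_{(s,s')}$, let $F^{(s,s')} = \langle F^{(s,s')}_1, \dots, F^{(s,s')}_{|X|}\rangle$ be Boolean functions over $I \cup (O \setminus X)$ such that for every assignment to $I \cup (O\setminus X)$, if $\exists X\, B_{(s,s')}$ holds then $B_{(s,s')}[X \mapsto F^{(s,s')}]$ holds. Let $\Lambda^X$ be the circuit with inputs $p_0,\dots,p_{k-1}$ and $I \cup (O\setminus X)$ whose output for $x_i \in X$ is $\bigvee_{(s,s')} \big(p_s \wedge B_{(s,s')}[X\mapsto F^{(s,s')}] \wedge F^{(s,s')}_i\big)$, the disjunction over all transitions $(s,s')$ of $A$, where $p_s = p_j$ for $s = s_j$. Let $U \subseteq S$ be a non-empty set of pairwise compatible states, encoded by $p_j = 1$ iff $s_j \in U$, and let $(\sigma_I,\sigma) \in \Sigma_I \times \Sigma_{O\setminus X}$. If $\delta^X(U,(\sigma_I,\sigma)) \ne \emptyset$, then the outputs $X$ of $\Lambda^X$ evaluate to $\lambda^X(U,(\sigma_I,\sigma))$; in all other cases every output of $\Lambda^X$ evaluates to $0$.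
   Context: $\Sigma_Z = 2^Z$; letters are triples $(\sigma_I,\sigma,\sigma') \in \Sigma_I \times \Sigma_{O\setminus X} \times \Sigma_X$. The label $B_{(s,s')}$ is the Boolean function over $I\cup O$ whose satisfying assignments are the letters $a$ with $s' \in \delta(s,a)$. $\delta^X(U,(\sigma_I,\sigma)) = \{q' \mid \exists q \in U\ \exists \sigma' \in \Sigma_X: q' \in \delta(q,(\sigma_I,\sigma,\sigma'))\}$; when this is nonempty, $\lambda^X(U,(\sigma_I,\sigma))$ is the unique $\sigma_X \in \Sigma_X$ with $\delta^X(U,(\sigma_I,\sigma)) = \{q' \mid \exists q \in U: q' \in \delta(q,(\sigma_I,\sigma,\sigma_X))\}$. A pair of states is compatible if some finite word has runs from the initial state to both. $X$ is automata dependent on $Y$ if for every compatible pair $(s,s')$ and letters $a,a'$ agreeing on $Y$ but not on $X$, not both $\delta(s,a)$ and $\delta(s',a')$ are nonempty. -}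

module Defs where

open import Data.Nat using (ℕ; zero; suc; _≤_)
open import Data.Fin using (Fin)
open import Data.Bool using (Bool; true; false; _∧_; _∨_)
open import Data.Vec using (Vec; []; _∷_; lookup; tabulate)
open import Data.List using (List; []; _∷_; map; concatMap; filterᵇ; allFin; cartesianProduct)
open import Data.Bool.ListAction using (or; any)
open import Data.Product using (Σ; ∃; _×_; _,_)
open import Relation.Binary.PropositionalEquality using (_≡_; _≢_)
open import Relation.Nullary using (¬_)

Assign : ℕ → Set
Assign n = Vec Bool n

allAssign : (n : ℕ) → List (Assign n)
allAssign zero = [] ∷ []
allAssign (suc n) = concatMap (λ v → (false ∷ v) ∷ (true ∷ v) ∷ []) (allAssign n)

-- Letters (σ_I, σ, σ') ∈ Σ_I × Σ_{O∖X} × Σ_X, with |I| = nI, |O∖X| = nY, |X| = nX.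
Letter : ℕ → ℕ → ℕ → Set
Letter nI nY nX = Assign nI × Assign nY × Assign nX

allLetters : (nI nY nX : ℕ) → List (Letter nI nY nX)
allLetters nI nY nX =
  concatMap (λ a → concatMap (λ b → map (λ c → (a , b , c)) (allAssign nX)) (allAssign nY)) (allAssign nI)

record NBA (nI nY nX : ℕ) : Set where
  field
    k     : ℕ
    init  : Fin k
    δ     : Fin k → Letter nI nY nX → Fin k → Bool   -- δ s a s' = true  iff  s' ∈ δ(s,a)
    acc   : Fin k → Bool

module _ {nI nY nX : ℕ} (A : NBA nI nY nX) where
  open NBA A

  B : Fin k → Fin k → Letter nI nY nX → Bool
  B s s' a = δ s a s'

  isTransition : Fin k → Fin k → Bool
  isTransition s s' = any (B s s') (allLetters nI nY nX)

  record AcceptingRun : Set where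
    field
      word  : ℕ → Letter nI nY nX
      run   : ℕ → Fin k
      start : run 0 ≡ init
      step  : ∀ i → δ (run i) (word i) (run (suc i)) ≡ true
      inf   : ∀ n → ∃ λ m → n ≤ m × acc (run m) ≡ true

  AllOnAcceptingRuns : Set
  AllOnAcceptingRuns =
    (∀ s → Σ AcceptingRun λ ρ → ∃ λ i → AcceptingRun.run ρ i ≡ s)
    × (∀ s s' → isTransition s s' ≡ true →
         Σ AcceptingRun λ ρ → ∃ λ i →
           AcceptingRun.run ρ i ≡ s × AcceptingRun.run ρ (suc i) ≡ s')

  data Reach : Fin k → List (Letter nI nY nX) → Fin k → Set where
    done : ∀ {s} → Reach s [] s
    next : ∀ {s t u a w} → δ s a t ≡ true → Reach t w u → Reach s (a ∷ w) u

  Compatible : Fin k → Fin k → Set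
  Compatible s s' = ∃ λ w → Reach init w s × Reach init w s'

  NonemptySucc : Fin k → Letter nI nY nX → Set
  NonemptySucc s a = ∃ λ t → δ s a t ≡ true

  AutomataDependent : Set
  AutomataDependent =
    ∀ s s' → Compatible s s' → ∀ σI σ σX σX' → σX ≢ σX' →
      ¬ (NonemptySucc s (σI , σ , σX) × NonemptySucc s' (σI , σ , σX'))

  -- U ⊆ S encoded as a Boolean vector (p_j = 1 iff s_j ∈ U)
  _∈U_ : Fin k → Vec Bool k → Set
  s ∈U U = lookup U s ≡ true

  δX : Vec Bool k → Assign nI → Assign nY → Fin k → Set
  δX U σI σ q' = ∃ λ q → q ∈U U × ∃ λ σ' → δ q (σI , σ , σ') q' ≡ true

  IsLambdaX : Vec Bool k → Assign nI → Assign nY → Assign nX → Set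
  IsLambdaX U σI σ σX =
    ∀ q' → (δX U σI σ q' → ∃ λ q → q ∈U U × δ q (σI , σ , σX) q' ≡ true)
         × ((∃ λ q → q ∈U U × δ q (σI , σ , σX) q' ≡ true) → δX U σI σ q')

  IsTheLambdaX : Vec Bool k → Assign nI → Assign nY → Assign nX → Set
  IsTheLambdaX U σI σ σX =
    IsLambdaX U σI σ σX × (∀ τ → IsLambdaX U σI σ τ → τ ≡ σX)

  FunctionsF : Set
  FunctionsF = Fin k → Fin k → Assign nI → Assign nY → Assign nX

  GoodF : FunctionsF → Set
  GoodF F = ∀ s s' σI σ →
    (∃ λ σX → B s s' (σI , σ , σX) ≡ true) → B s s' (σI , σ , F s s' σI σ) ≡ true

  ΛX : FunctionsF → Vec Bool k → Assign nI → Assign nY → Assign nX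
  ΛX F p σI σ = tabulate λ i →
    or (map (λ { (s , s') → lookup p s ∧ B s s' (σI , σ , F s s' σI σ) ∧ lookup (F s s' σI σ) i })
            (filterᵇ (λ { (s , s') → isTransition s s' }) (cartesianProduct (allFin k) (allFin k))))

{-# OPTIONS --safe #-}
module Submission where

-- Automata dependence, applied to the pairwise compatible states of U, forces all letters
-- (σ_I, σ, σ_X) that enable a transition out of U to share one X-part σ₀. By the hypothesis
-- on F, a disjunct of Λ^X whose guard p_s ∧ B_(s,s')[X ↦ F^(s,s')] holds has F^(s,s') enabling
-- (s,s'), so F^(s,s') = σ₀ and the disjunct contributes exactly σ₀; the disjunct of any enabled
-- transition is active, so every bit of σ₀ is produced. When no transition is enabled, no guard
-- holds and all outputs are 0. Finally σ₀ = λ^X(U,(σ_I,σ)): it meets the defining equation, and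
-- any solution τ enables a transition out of U, so τ = σ₀.

open import Defs
open import Data.Nat using (ℕ; zero; suc)
open import Data.Fin using (Fin)
open import Data.Bool using (Bool; false; true; _∧_; T?)
open import Data.Bool.Properties using (T-≡) renaming (_≟_ to _≟B_)
open import Data.Bool.ListAction using (any)
open import Data.Vec using (Vec; []; _∷_; lookup; replicate; tabulate)
open import Data.Vec.Properties using (tabulate-cong; tabulate∘lookup; ≡-dec; lookup-replicate)
open import Data.List using (List; []; _∷_; filterᵇ; allFin; cartesianProduct)
open import Data.List.Membership.Propositional using (_∈_; lose)
open import Data.List.Membership.Propositional.Properties
  using (∈-concatMap⁺; ∈-map⁺; ∈-cartesianProduct⁺; ∈-allFin; ∈-filter⁺)
open import Data.List.Relation.Unary.Any as Any using (Any; here; there)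
open import Data.List.Relation.Unary.Any.Properties using (any⁺)
open import Data.Product using (∃; _×_; _,_; proj₁)
open import Data.Empty using (⊥-elim)
open import Function using (_∘_; Equivalence)
open import Relation.Binary.PropositionalEquality using (_≡_; refl; sym; trans; subst)
open import Relation.Nullary using (¬_)
open import Relation.Nullary.Decidable using (decidable-stable)

module _ {a} {A : Set a} (p : A → Bool) where

  any-true : ∀ {xs} → Any (λ x → p x ≡ true) xs → any p xs ≡ true
  any-true = Equivalence.to T-≡ ∘ any⁺ p ∘ Any.map (Equivalence.from T-≡)

  any-≡ : ∀ {b} xs → (∀ x → p x ≡ true → b ≡ true) →
          (b ≡ true → Any (λ x → p x ≡ true) xs) → any p xs ≡ b
  any-≡ {true}  xs       _     witness = any-true (witness refl)
  any-≡ {false} []       _     _       = refl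
  any-≡ {false} (x ∷ xs) sound _       with p x in px
  ... | true  = sym (sound x px)
  ... | false = any-≡ xs sound λ ()

∧-true⁻ : ∀ x y z → x ∧ y ∧ z ≡ true → x ≡ true × y ≡ true × z ≡ true
∧-true⁻ true true true refl = refl , refl , refl

tabulate-≡ : ∀ {a} {A : Set a} {n} {f : Fin n → A} {v : Vec A n} →
             (∀ i → f i ≡ lookup v i) → tabulate f ≡ v
tabulate-≡ {v = v} f≗v = trans (tabulate-cong f≗v) (tabulate∘lookup v)

∈-allAssign : ∀ n (v : Assign n) → v ∈ allAssign n
∈-allAssign zero    []          = here refl
∈-allAssign (suc n) (false ∷ v) =
  ∈-concatMap⁺ _ (Any.map (λ { refl → here refl }) (∈-allAssign n v))
∈-allAssign (suc n) (true ∷ v)  =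
  ∈-concatMap⁺ _ (Any.map (λ { refl → there (here refl) }) (∈-allAssign n v))

∈-allLetters : ∀ {nI nY nX} (a : Letter nI nY nX) → a ∈ allLetters nI nY nX
∈-allLetters {nI} {nY} {nX} (σI , σ , σX) =
  ∈-concatMap⁺ _ (Any.map (λ { refl →
    ∈-concatMap⁺ _ (Any.map (λ { refl → ∈-map⁺ _ (∈-allAssign nX σX) }) (∈-allAssign nY σ)) })
    (∈-allAssign nI σI))

module _ {nI nY nX : ℕ} (A : NBA nI nY nX) where
  open NBA A

  transitions : List (Fin k × Fin k)
  transitions = filterᵇ (λ { (s , s') → isTransition A s s' }) (cartesianProduct (allFin k) (allFin k))

  ∈-transitions : ∀ {s s' a} → δ s a s' ≡ true → (s , s') ∈ transitions
  ∈-transitions {s} {s'} {a} e =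
    ∈-filter⁺ (λ { (s , s') → T? (isTransition A s s') })
              (∈-cartesianProduct⁺ (∈-allFin s) (∈-allFin s'))
              (Equivalence.from T-≡ (any-true (B A s s') (lose (∈-allLetters a) e)))

  PairwiseCompatible : Vec Bool k → Set
  PairwiseCompatible U = ∀ s s' → _∈U_ A s U → _∈U_ A s' U → Compatible A s s'

  module _ (F : FunctionsF A) (U : Vec Bool k) (σI : Assign nI) (σ : Assign nY) where

    -- ΛX A F U σI σ unfolds to tabulate (λ i → any (Λ-term i) transitions).
    Λ-term : Fin nX → Fin k × Fin k → Bool
    Λ-term i (s , s') = lookup U s ∧ B A s s' (σI , σ , F s s' σI σ) ∧ lookup (F s s' σI σ) i

    Λ-term-true⁻ : ∀ i {s s'} → Λ-term i (s , s') ≡ true →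
      _∈U_ A s U × B A s s' (σI , σ , F s s' σI σ) ≡ true × lookup (F s s' σI σ) i ≡ true
    Λ-term-true⁻ i {s} {s'} =
      ∧-true⁻ (lookup U s) (B A s s' (σI , σ , F s s' σI σ)) (lookup (F s s' σI σ) i)

    Λ-term-true⁺ : ∀ i {s s'} → _∈U_ A s U → B A s s' (σI , σ , F s s' σI σ) ≡ true →
      lookup (F s s' σI σ) i ≡ true → Λ-term i (s , s') ≡ true
    Λ-term-true⁺ i sU eB eF rewrite sU | eB | eF = refl

    ΛX-disabled : ¬ (∃ λ q' → δX A U σI σ q') → ΛX A F U σI σ ≡ replicate nX false
    ΛX-disabled none = tabulate-≡ λ i →
      trans (any-≡ (Λ-term i) transitions (inactive i) λ ()) (sym (lookup-replicate i false))
      where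
      inactive : ∀ i x → Λ-term i x ≡ true → false ≡ true
      inactive i (s , s') e with Λ-term-true⁻ i e
      ... | sU , eB , _ = ⊥-elim (none (s' , s , sU , F s s' σI σ , eB))

  module _ (dep : AutomataDependent A) (U : Vec Bool k) (compat : PairwiseCompatible U)
           (σI : Assign nI) (σ : Assign nY) where

    enabled-X-unique : ∀ {q q' t t' σX σX'} → _∈U_ A q U → _∈U_ A q' U →
      δ q (σI , σ , σX) t ≡ true → δ q' (σI , σ , σX') t' ≡ true → σX ≡ σX'
    enabled-X-unique {q} {q'} {t} {t'} {σX} {σX'} qU q'U e e' =
      decidable-stable (≡-dec _≟B_ σX σX') λ σX≢σX' →
        dep q q' (compat q q' qU q'U) σI σ σX σX' σX≢σX' ((t , e) , (t' , e'))

    module _ {q₀ t₀ σ₀} (q₀∈U : _∈U_ A q₀ U) (enabled : δ q₀ (σI , σ , σ₀) t₀ ≡ true) where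

      enabled⇒≡σ₀ : ∀ {q t σX} → _∈U_ A q U → δ q (σI , σ , σX) t ≡ true → σX ≡ σ₀
      enabled⇒≡σ₀ qU e = enabled-X-unique qU q₀∈U e enabled

      isTheLambdaX-enabled : IsTheLambdaX A U σI σ σ₀
      isTheLambdaX-enabled = isLambdaX , unique
        where
        isLambdaX : IsLambdaX A U σI σ σ₀
        isLambdaX q' =
          (λ { (q , qU , σX , e) →
                 q , qU , subst (λ τ → δ q (σI , σ , τ) q' ≡ true) (enabled⇒≡σ₀ qU e) e })
          , λ { (q , qU , e) → q , qU , σ₀ , e }

        unique : ∀ τ → IsLambdaX A U σI σ τ → τ ≡ σ₀
        unique τ isτ with proj₁ (isτ t₀) (q₀ , q₀∈U , σ₀ , enabled)
        ... | q , qU , e = enabled⇒≡σ₀ qU e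

      ΛX-enabled : (F : FunctionsF A) → GoodF A F → ΛX A F U σI σ ≡ σ₀
      ΛX-enabled F good =
        tabulate-≡ λ i → any-≡ (Λ-term F U σI σ i) transitions (sound i) (complete i)
        where
        F₀-enabled : B A q₀ t₀ (σI , σ , F q₀ t₀ σI σ) ≡ true
        F₀-enabled = good q₀ t₀ σI σ (σ₀ , enabled)

        sound : ∀ i x → Λ-term F U σI σ i x ≡ true → lookup σ₀ i ≡ true
        sound i (s , s') e with Λ-term-true⁻ F U σI σ i e
        ... | sU , eB , eF = subst (λ τ → lookup τ i ≡ true) (enabled⇒≡σ₀ sU eB) eF

        complete : ∀ i → lookup σ₀ i ≡ true → Any (λ x → Λ-term F U σI σ i x ≡ true) transitions
        complete i e = lose (∈-transitions enabled) (Λ-term-true⁺ F U σI σ i q₀∈U F₀-enabled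
          (subst (λ τ → lookup τ i ≡ true) (sym (enabled⇒≡σ₀ q₀∈U F₀-enabled)) e))

lemma3 : ∀ {nI nY nX : ℕ} (A : NBA nI nY nX) →
  AllOnAcceptingRuns A → AutomataDependent A →
  (F : FunctionsF A) → GoodF A F →
  (U : Vec Bool (NBA.k A)) → (∃ λ s → _∈U_ A s U) →
  (∀ s s' → _∈U_ A s U → _∈U_ A s' U → Compatible A s s') →
  (σI : Assign nI) (σ : Assign nY) →
  ((∃ λ q' → δX A U σI σ q') → IsTheLambdaX A U σI σ (ΛX A F U σI σ))
  × (¬ (∃ λ q' → δX A U σI σ q') → ΛX A F U σI σ ≡ replicate nX false)
lemma3 A _ dep F good U _ compat σI σ = enabled-case , ΛX-disabled A F U σI σ
  where
  enabled-case : (∃ λ q' → δX A U σI σ q') → IsTheLambdaX A U σI σ (ΛX A F U σI σ)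
  enabled-case (t₀ , q₀ , q₀∈U , σ₀ , enabled) =
    subst (IsTheLambdaX A U σI σ) (sym (ΛX-enabled A dep U compat σI σ q₀∈U enabled F good))
          (isTheLambdaX-enabled A dep U compat σI σ q₀∈U enabled)
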